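{- Let $G$ be a graph on $n$ vertices and $1\le k<n$ such that $F_k(G)$ is regular. Then $F_k(\overline{G})$ is also regular.
   Context: All graphs are finite and simple; $\overline{G}$ is the complement of $G$. For a graph $G=(V,E)$ on $n$ vertices and $1\le k<n$, the $k$-token graph $F_k(G)$ has as vertices the $k$-element subsets of $V$, with $A,B$ adjacent whenever $A\triangle B=\{a,b\}$ for some edge $ab$ of $G$. -}

module Defs where

open import Data.Nat using (ℕ; zero; suc; _≡ᵇ_)
open import Data.Bool using (Bool; true; false; not; _∧_; _∨_; _xor_)
open import Data.Fin using (Fin; _≟_)
open import Data.Fin.Subset using (Subset; ⁅_⁆; _∪_; ∣_∣)
open import Data.Vec using (Vec; []; _∷_; zipWith)
open import Data.List using (List; []; _∷_; map; _++_; allFin; filterᵇ; length)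
open import Data.Product using (∃)
open import Data.Bool.ListAction using (any)
open import Relation.Nullary.Decidable using (⌊_⌋)
open import Relation.Binary.PropositionalEquality using (_≡_; refl; cong; cong₂; trans) renaming (sym to sym≡)
open import Relation.Nullary using (yes; no)
open import Data.Empty using (⊥-elim)
open import Data.Bool.Properties using () renaming (_≟_ to _≟B_)
import Data.Vec.Properties as VP

record Graph (n : ℕ) : Set where
  field
    adj    : Fin n → Fin n → Bool
    sym    : ∀ i j → adj i j ≡ adj j i
    irrefl : ∀ i → adj i i ≡ false
open Graph public

private
  ≟-sym : ∀ {n} (i j : Fin n) → ⌊ i ≟ j ⌋ ≡ ⌊ j ≟ i ⌋
  ≟-sym i j with i ≟ j | j ≟ i
  ... | yes _ | yes _ = refl
  ... | no _  | no _  = refl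
  ... | yes p | no q  = ⊥-elim (q (sym≡ p))
  ... | no q  | yes p = ⊥-elim (q (sym≡ p))

  ≟-refl : ∀ {n} (i : Fin n) → ⌊ i ≟ i ⌋ ≡ true
  ≟-refl i with i ≟ i
  ... | yes _ = refl
  ... | no q = ⊥-elim (q refl)

  ∧-false : ∀ b → b ∧ false ≡ false
  ∧-false true = refl
  ∧-false false = refl

complement : ∀ {n} → Graph n → Graph n
complement G = record
  { adj    = λ i j → not (adj G i j) ∧ not ⌊ i ≟ j ⌋
  ; sym    = λ i j → cong₂ (λ x y → not x ∧ not y) (sym G i j) (≟-sym i j)
  ; irrefl = λ i → trans
               (cong (λ y → not (adj G i i) ∧ not y) (≟-refl i)) (∧-false (not (adj G i i)))
  }

_△_ : ∀ {n} → Subset n → Subset n → Subset n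
_△_ = zipWith _xor_

allSubsets : ∀ n → List (Subset n)
allSubsets zero    = [] ∷ []
allSubsets (suc n) = map (true ∷_) (allSubsets n) ++ map (false ∷_) (allSubsets n)

tokenAdj : ∀ {n} → Graph n → Subset n → Subset n → Bool
tokenAdj {n} G A B =
  any (λ a → any (λ b → adj G a b ∧ ⌊ VP.≡-dec _≟B_ (A △ B) (⁅ a ⁆ ∪ ⁅ b ⁆) ⌋) (allFin n)) (allFin n)

isToken : ∀ {n} → ℕ → Subset n → Bool
isToken k A = ∣ A ∣ ≡ᵇ k

tokenDegree : ∀ {n} → Graph n → ℕ → Subset n → ℕ
tokenDegree {n} G k A = length (filterᵇ (λ B → isToken k B ∧ tokenAdj G A B) (allSubsets n))

TokenRegular : ∀ {n} → Graph n → ℕ → Set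
TokenRegular G k = ∃ λ d → ∀ A → ∣ A ∣ ≡ k → tokenDegree G k A ≡ d

-- Write Ḡ for the complement of G. A k-set B is adjacent to the k-set A in F_k(G) or in
-- F_k(Ḡ), and never in both, exactly when A △ B is a pair, i.e. when B arises from A by
-- removing one element and adding another; there are k(n - k) such B. Hence
-- deg_G(A) + deg_Ḡ(A) = k(n - k) for every vertex A, and if F_k(G) is d-regular then F_k(Ḡ)
-- is (k(n - k) - d)-regular.
module Submission where

open import Defs hiding (sym)
open import Data.Bool using (Bool; true; false; not; T; _∧_; _∨_)
open import Data.Bool.Properties using (T-∧; T-∨; T-not-≡; ∧-distribˡ-∨; ∧-identityʳ; ∧-zeroʳ)
open import Data.Empty using (⊥-elim)
open import Data.Fin using (Fin; zero; suc; _≟_)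
import Data.Fin.Properties as Fin
open import Data.Fin.Subset using (Subset; _∈_; ⊥; ⁅_⁆; _∪_; _─_; ∁; ∣_∣)
open import Data.Fin.Subset.Properties
  using (∣⁅x⁆∣≡1; ∣∁p∣≡n∸∣p∣; x∈⁅x⁆; x∈⁅y⁆⇒x≡y; x∈p∪q⁺; x∈p∪q⁻; ∪-identityˡ; ∪-identityʳ)
open import Data.List using (List; []; _∷_; _++_; map; filterᵇ; length; allFin)
open import Data.List.Membership.Propositional using (lose)
open import Data.List.Membership.Propositional.Properties using (∈-allFin)
open import Data.List.Relation.Unary.Any using (satisfied)
open import Data.List.Relation.Unary.Any.Properties using (any⁺; any⁻)
open import Data.Nat using (ℕ; zero; suc; _+_; _*_; _∸_; _≡ᵇ_; _≤_; _<_)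
open import Data.Nat.Combinatorics using (_C_; nC1≡n; nCk+nC[k+1]≡[n+1]C[k+1])
open import Data.Nat.Properties
  using (+-suc; +-comm; +-identityʳ; *-distribˡ-+; *-distribʳ-+; +-cancelˡ-≡; +-cancelʳ-≡;
         m+n≡0⇒n≡0; m+n∸m≡n; suc-injective; ≡ᵇ⇒≡; ≡⇒≡ᵇ)
open import Data.Product using (∃; ∃₂; _×_; _,_; proj₂)
open import Data.Vec using ([]; _∷_)
open import Data.Sum using (_⊎_; inj₁; inj₂; [_,_])
import Data.Sum as Sum
open import Function using (_∘_; _⇔_; mk⇔; Equivalence)
open import Function.Construct.Composition using (_⇔-∘_)
open import Function.Construct.Symmetry using (⇔-sym)
open import Relation.Binary.PropositionalEquality
  using (_≡_; _≢_; refl; sym; trans; cong; cong₂; subst; module ≡-Reasoning)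
open import Relation.Nullary using (¬_; yes; no)
open import Relation.Nullary.Decidable using (toWitness; fromWitness)

open Equivalence using (to; from)

T⇔T⇒≡ : ∀ {x y} → T x ⇔ T y → x ≡ y
T⇔T⇒≡ {false} {false} _ = refl
T⇔T⇒≡ {false} {true}  h = ⊥-elim (from h _)
T⇔T⇒≡ {true}  {false} h = ⊥-elim (to h _)
T⇔T⇒≡ {true}  {true}  _ = refl

count : ∀ {A : Set} → (A → Bool) → List A → ℕ
count p xs = length (filterᵇ p xs)

module _ {A : Set} where

  count-++ : (p : A → Bool) (xs ys : List A) → count p (xs ++ ys) ≡ count p xs + count p ys
  count-++ p []       ys = refl
  count-++ p (x ∷ xs) ys with p x
  ... | true  = cong suc (count-++ p xs ys)
  ... | false = count-++ p xs ys

  count-map : ∀ {B : Set} (p : A → Bool) (f : B → A) (xs : List B) →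
    count p (map f xs) ≡ count (p ∘ f) xs
  count-map p f []       = refl
  count-map p f (x ∷ xs) with p (f x)
  ... | true  = cong suc (count-map p f xs)
  ... | false = count-map p f xs

  count-cong : {p q : A → Bool} → (∀ x → p x ≡ q x) → (xs : List A) → count p xs ≡ count q xs
  count-cong p≗q []       = refl
  count-cong {p} {q} p≗q (x ∷ xs) with p x | q x | p≗q x
  ... | true  | .true  | refl = cong suc (count-cong p≗q xs)
  ... | false | .false | refl = count-cong p≗q xs

  count-false : {p : A → Bool} → (∀ x → p x ≡ false) → (xs : List A) → count p xs ≡ 0
  count-false p≗false []       = refl
  count-false {p} p≗false (x ∷ xs) with p x | p≗false x
  ... | false | refl = count-false p≗false xs

  count-∨ : {p q : A → Bool} → (∀ x → T (p x) → ¬ T (q x)) → (xs : List A) →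
    count (λ x → p x ∨ q x) xs ≡ count p xs + count q xs
  count-∨ disjoint []       = refl
  count-∨ {p} {q} disjoint (x ∷ xs) with p x | q x | disjoint x
  ... | true  | true  | d = ⊥-elim (d _ _)
  ... | true  | false | _ = cong suc (count-∨ disjoint xs)
  ... | false | true  | _ = trans (cong suc (count-∨ disjoint xs)) (sym (+-suc _ _))
  ... | false | false | _ = count-∨ disjoint xs

count-allSubsets-suc : ∀ {n} (p : Subset (suc n) → Bool) →
  count p (allSubsets (suc n)) ≡ count (p ∘ (true ∷_)) (allSubsets n) + count (p ∘ (false ∷_)) (allSubsets n)
count-allSubsets-suc {n} p = trans (count-++ p (map (true ∷_) S) (map (false ∷_) S))
                                   (cong₂ _+_ (count-map p (true ∷_) S) (count-map p (false ∷_) S))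
  where S = allSubsets n

∣p△q∣≡∣p─q∣+∣q─p∣ : ∀ {n} (p q : Subset n) → ∣ p △ q ∣ ≡ ∣ p ─ q ∣ + ∣ q ─ p ∣
∣p△q∣≡∣p─q∣+∣q─p∣ []          []          = refl
∣p△q∣≡∣p─q∣+∣q─p∣ (true  ∷ p) (true  ∷ q) = ∣p△q∣≡∣p─q∣+∣q─p∣ p q
∣p△q∣≡∣p─q∣+∣q─p∣ (true  ∷ p) (false ∷ q) = cong suc (∣p△q∣≡∣p─q∣+∣q─p∣ p q)
∣p△q∣≡∣p─q∣+∣q─p∣ (false ∷ p) (true  ∷ q) = trans (cong suc (∣p△q∣≡∣p─q∣+∣q─p∣ p q)) (sym (+-suc _ _))
∣p△q∣≡∣p─q∣+∣q─p∣ (false ∷ p) (false ∷ q) = ∣p△q∣≡∣p─q∣+∣q─p∣ p q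

∣p∣+∣q─p∣≡∣q∣+∣p─q∣ : ∀ {n} (p q : Subset n) → ∣ p ∣ + ∣ q ─ p ∣ ≡ ∣ q ∣ + ∣ p ─ q ∣
∣p∣+∣q─p∣≡∣q∣+∣p─q∣ []          []          = refl
∣p∣+∣q─p∣≡∣q∣+∣p─q∣ (true  ∷ p) (true  ∷ q) = cong suc (∣p∣+∣q─p∣≡∣q∣+∣p─q∣ p q)
∣p∣+∣q─p∣≡∣q∣+∣p─q∣ (true  ∷ p) (false ∷ q) = trans (cong suc (∣p∣+∣q─p∣≡∣q∣+∣p─q∣ p q)) (sym (+-suc _ _))
∣p∣+∣q─p∣≡∣q∣+∣p─q∣ (false ∷ p) (true  ∷ q) = trans (+-suc _ _) (cong suc (∣p∣+∣q─p∣≡∣q∣+∣p─q∣ p q))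
∣p∣+∣q─p∣≡∣q∣+∣p─q∣ (false ∷ p) (false ∷ q) = ∣p∣+∣q─p∣≡∣q∣+∣p─q∣ p q

differsBy : ∀ {n} → Subset n → ℕ → ℕ → Subset n → Bool
differsBy A i j B = (∣ A ─ B ∣ ≡ᵇ i) ∧ (∣ B ─ A ∣ ≡ᵇ j)

count-differsBy : ∀ {n} (A : Subset n) i j →
  count (differsBy A i j) (allSubsets n) ≡ (∣ A ∣ C i) * (∣ ∁ A ∣ C j)
count-differsBy []          zero    zero    = refl
count-differsBy []          zero    (suc j) = refl
count-differsBy []          (suc i) j       = refl
count-differsBy (true ∷ A)  zero    j       = begin
  count (differsBy (true ∷ A) zero j) (allSubsets _)
    ≡⟨ count-allSubsets-suc (differsBy (true ∷ A) zero j) ⟩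
  count (differsBy A 0 j) S + count (λ _ → false) S
    ≡⟨ cong₂ _+_ (count-differsBy A 0 j) (count-false (λ _ → refl) S) ⟩
  (∣ A ∣ C 0) * (∣ ∁ A ∣ C j) + 0
    ≡⟨ +-identityʳ _ ⟩
  (∣ A ∣ C 0) * (∣ ∁ A ∣ C j) ∎
  where open ≡-Reasoning; S = allSubsets _
count-differsBy (true ∷ A)  (suc i) j       = begin
  count (differsBy (true ∷ A) (suc i) j) (allSubsets _)
    ≡⟨ count-allSubsets-suc (differsBy (true ∷ A) (suc i) j) ⟩
  count (differsBy A (suc i) j) S + count (differsBy A i j) S
    ≡⟨ cong₂ _+_ (count-differsBy A (suc i) j) (count-differsBy A i j) ⟩
  (a C suc i) * (c C j) + (a C i) * (c C j) ≡⟨ sym (*-distribʳ-+ (c C j) (a C suc i) (a C i)) ⟩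
  (a C suc i + a C i) * (c C j)             ≡⟨ cong (_* (c C j)) (+-comm (a C suc i) (a C i)) ⟩
  (a C i + a C suc i) * (c C j)             ≡⟨ cong (_* (c C j)) (nCk+nC[k+1]≡[n+1]C[k+1] a i) ⟩
  (suc a C suc i) * (c C j)                 ∎
  where open ≡-Reasoning; S = allSubsets _; a = ∣ A ∣; c = ∣ ∁ A ∣
count-differsBy (false ∷ A) i       zero    = begin
  count (differsBy (false ∷ A) i zero) (allSubsets _)
    ≡⟨ count-allSubsets-suc (differsBy (false ∷ A) i zero) ⟩
  count (λ B → (∣ A ─ B ∣ ≡ᵇ i) ∧ false) S + count (differsBy A i 0) S
    ≡⟨ cong₂ _+_ (count-false (λ B → ∧-zeroʳ _) S) (count-differsBy A i 0) ⟩
  (∣ A ∣ C i) * (∣ ∁ A ∣ C 0) ∎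
  where open ≡-Reasoning; S = allSubsets _
count-differsBy (false ∷ A) i       (suc j) = begin
  count (differsBy (false ∷ A) i (suc j)) (allSubsets _)
    ≡⟨ count-allSubsets-suc (differsBy (false ∷ A) i (suc j)) ⟩
  count (differsBy A i j) S + count (differsBy A i (suc j)) S
    ≡⟨ cong₂ _+_ (count-differsBy A i j) (count-differsBy A i (suc j)) ⟩
  (a C i) * (c C j) + (a C i) * (c C suc j) ≡⟨ sym (*-distribˡ-+ (a C i) (c C j) (c C suc j)) ⟩
  (a C i) * (c C j + c C suc j)             ≡⟨ cong ((a C i) *_) (nCk+nC[k+1]≡[n+1]C[k+1] c j) ⟩
  (a C i) * (suc c C suc j)                 ∎
  where open ≡-Reasoning; S = allSubsets _; a = ∣ A ∣; c = ∣ ∁ A ∣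

m+m≡2⇒m≡1 : ∀ {m} → m + m ≡ 2 → m ≡ 1
m+m≡2⇒m≡1 {zero}        ()
m+m≡2⇒m≡1 {suc zero}    _  = refl
m+m≡2⇒m≡1 {suc (suc m)} eq with m+n≡0⇒n≡0 m (suc-injective (suc-injective eq))
... | ()

sameSize-distance2⇔ : ∀ {a b i j} → a + j ≡ b + i → (b ≡ a × i + j ≡ 2) ⇔ (i ≡ 1 × j ≡ 1)
sameSize-distance2⇔ {a} {b} {i} {j} eq = mk⇔ (λ (b≡a , i+j≡2) → ⇒ b≡a i+j≡2) ⇐
  where
  ⇒ : b ≡ a → i + j ≡ 2 → i ≡ 1 × j ≡ 1
  ⇒ refl i+j≡2 with +-cancelˡ-≡ a j i eq
  ... | refl = m+m≡2⇒m≡1 i+j≡2 , m+m≡2⇒m≡1 i+j≡2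
  ⇐ : i ≡ 1 × j ≡ 1 → b ≡ a × i + j ≡ 2
  ⇐ (refl , refl) = sym (+-cancelʳ-≡ 1 a b eq) , refl

T-≡ᵇ∧≡ᵇ : ∀ {m n m′ n′} → T ((m ≡ᵇ n) ∧ (m′ ≡ᵇ n′)) ⇔ (m ≡ n × m′ ≡ n′)
T-≡ᵇ∧≡ᵇ {m} {n} {m′} {n′} = mk⇔
  (λ t → let p , q = to T-∧ t in ≡ᵇ⇒≡ m n p , ≡ᵇ⇒≡ m′ n′ q)
  (λ (p , q) → from T-∧ (≡⇒≡ᵇ m n p , ≡⇒≡ᵇ m′ n′ q))

sameSize-distance2 : ∀ {a b i j} → a + j ≡ b + i →
  (b ≡ᵇ a) ∧ (i + j ≡ᵇ 2) ≡ (i ≡ᵇ 1) ∧ (j ≡ᵇ 1)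
sameSize-distance2 {a} {b} {i} {j} eq = T⇔T⇒≡
  (⇔-sym (T-≡ᵇ∧≡ᵇ {i} {1} {j} {1}) ⇔-∘ (sameSize-distance2⇔ {a} {b} {i} {j} eq ⇔-∘ T-≡ᵇ∧≡ᵇ {b} {a} {i + j} {2}))

sameSize-distance2≡differsBy-1-1 : ∀ {n} (A B : Subset n) →
  isToken ∣ A ∣ B ∧ (∣ A △ B ∣ ≡ᵇ 2) ≡ differsBy A 1 1 B
sameSize-distance2≡differsBy-1-1 A B = begin
  (∣ B ∣ ≡ᵇ ∣ A ∣) ∧ (∣ A △ B ∣ ≡ᵇ 2)
    ≡⟨ cong (λ m → (∣ B ∣ ≡ᵇ ∣ A ∣) ∧ (m ≡ᵇ 2)) (∣p△q∣≡∣p─q∣+∣q─p∣ A B) ⟩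
  (∣ B ∣ ≡ᵇ ∣ A ∣) ∧ (∣ A ─ B ∣ + ∣ B ─ A ∣ ≡ᵇ 2)
    ≡⟨ sameSize-distance2 {∣ A ∣} {∣ B ∣} {∣ A ─ B ∣} {∣ B ─ A ∣} (∣p∣+∣q─p∣≡∣q∣+∣p─q∣ A B) ⟩
  differsBy A 1 1 B ∎
  where open ≡-Reasoning

count-sameSize-distance2 : ∀ {n} (A : Subset n) →
  count (λ B → isToken ∣ A ∣ B ∧ (∣ A △ B ∣ ≡ᵇ 2)) (allSubsets n) ≡ ∣ A ∣ * (n ∸ ∣ A ∣)
count-sameSize-distance2 {n} A = begin
  count (λ B → isToken ∣ A ∣ B ∧ (∣ A △ B ∣ ≡ᵇ 2)) (allSubsets n)
    ≡⟨ count-cong (sameSize-distance2≡differsBy-1-1 A) (allSubsets n) ⟩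
  count (differsBy A 1 1) (allSubsets n)
    ≡⟨ count-differsBy A 1 1 ⟩
  (∣ A ∣ C 1) * (∣ ∁ A ∣ C 1)
    ≡⟨ cong₂ _*_ (nC1≡n ∣ A ∣) (trans (nC1≡n ∣ ∁ A ∣) (∣∁p∣≡n∸∣p∣ A)) ⟩
  ∣ A ∣ * (n ∸ ∣ A ∣) ∎
  where open ≡-Reasoning

∣p∣≡0⇒p≡⊥ : ∀ {n} (p : Subset n) → ∣ p ∣ ≡ 0 → p ≡ ⊥
∣p∣≡0⇒p≡⊥ []          _      = refl
∣p∣≡0⇒p≡⊥ (false ∷ p) ∣p∣≡0 = cong (false ∷_) (∣p∣≡0⇒p≡⊥ p ∣p∣≡0)

∣p∣≡1⇒p≡⁅x⁆ : ∀ {n} (p : Subset n) → ∣ p ∣ ≡ 1 → ∃ λ x → p ≡ ⁅ x ⁆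
∣p∣≡1⇒p≡⁅x⁆ (true  ∷ p) ∣p∣≡1 = zero , cong (true ∷_) (∣p∣≡0⇒p≡⊥ p (suc-injective ∣p∣≡1))
∣p∣≡1⇒p≡⁅x⁆ (false ∷ p) ∣p∣≡1 =
  let x , p≡⁅x⁆ = ∣p∣≡1⇒p≡⁅x⁆ p ∣p∣≡1 in suc x , cong (false ∷_) p≡⁅x⁆

∣p∣≡2⇒p≡⁅x⁆∪⁅y⁆ : ∀ {n} (p : Subset n) → ∣ p ∣ ≡ 2 → ∃₂ λ x y → x ≢ y × p ≡ ⁅ x ⁆ ∪ ⁅ y ⁆
∣p∣≡2⇒p≡⁅x⁆∪⁅y⁆ (true  ∷ p) ∣p∣≡2 =
  let y , p≡⁅y⁆ = ∣p∣≡1⇒p≡⁅x⁆ p (suc-injective ∣p∣≡2)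
  in zero , suc y , (λ ()) , cong (true ∷_) (trans p≡⁅y⁆ (sym (∪-identityˡ ⁅ y ⁆)))
∣p∣≡2⇒p≡⁅x⁆∪⁅y⁆ (false ∷ p) ∣p∣≡2 =
  let x , y , x≢y , p≡⁅x⁆∪⁅y⁆ = ∣p∣≡2⇒p≡⁅x⁆∪⁅y⁆ p ∣p∣≡2
  in suc x , suc y , x≢y ∘ Fin.suc-injective , cong (false ∷_) p≡⁅x⁆∪⁅y⁆

∣⁅x⁆∪⁅y⁆∣≡2 : ∀ {n} {x y : Fin n} → x ≢ y → ∣ ⁅ x ⁆ ∪ ⁅ y ⁆ ∣ ≡ 2
∣⁅x⁆∪⁅y⁆∣≡2 {x = zero}  {zero}  x≢y = ⊥-elim (x≢y refl)
∣⁅x⁆∪⁅y⁆∣≡2 {x = zero}  {suc y} _   = cong suc (trans (cong ∣_∣ (∪-identityˡ ⁅ y ⁆)) (∣⁅x⁆∣≡1 y))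
∣⁅x⁆∪⁅y⁆∣≡2 {x = suc x} {zero}  _   = cong suc (trans (cong ∣_∣ (∪-identityʳ ⁅ x ⁆)) (∣⁅x⁆∣≡1 x))
∣⁅x⁆∪⁅y⁆∣≡2 {x = suc x} {suc y} x≢y = ∣⁅x⁆∪⁅y⁆∣≡2 (x≢y ∘ cong suc)

x∈⁅y⁆∪⁅z⁆⇒x≡y⊎x≡z : ∀ {n} {x y z : Fin n} → x ∈ ⁅ y ⁆ ∪ ⁅ z ⁆ → x ≡ y ⊎ x ≡ z
x∈⁅y⁆∪⁅z⁆⇒x≡y⊎x≡z {y = y} {z} x∈ with x∈p∪q⁻ ⁅ y ⁆ ⁅ z ⁆ x∈
... | inj₁ x∈⁅y⁆ = inj₁ (x∈⁅y⁆⇒x≡y y x∈⁅y⁆)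
... | inj₂ x∈⁅z⁆ = inj₂ (x∈⁅y⁆⇒x≡y z x∈⁅z⁆)

adj-respects-pair : ∀ {n} (H : Graph n) {a b c d} → a ≢ b →
  ⁅ a ⁆ ∪ ⁅ b ⁆ ≡ ⁅ c ⁆ ∪ ⁅ d ⁆ → adj H a b ≡ adj H c d
adj-respects-pair H {a} {b} a≢b eq
  with x∈⁅y⁆∪⁅z⁆⇒x≡y⊎x≡z (subst (a ∈_) eq (x∈p∪q⁺ (inj₁ (x∈⁅x⁆ a))))
     | x∈⁅y⁆∪⁅z⁆⇒x≡y⊎x≡z (subst (b ∈_) eq (x∈p∪q⁺ (inj₂ (x∈⁅x⁆ b))))
... | inj₁ refl | inj₂ refl = refl
... | inj₂ refl | inj₁ refl = Graph.sym H a b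
... | inj₁ refl | inj₁ refl = ⊥-elim (a≢b refl)
... | inj₂ refl | inj₂ refl = ⊥-elim (a≢b refl)

adj⇒≢ : ∀ {n} (H : Graph n) {a b} → T (adj H a b) → a ≢ b
adj⇒≢ H {a} t refl = subst T (irrefl H a) t

adj-complement : ∀ {n} (G : Graph n) {a b} → a ≢ b → adj (complement G) a b ≡ not (adj G a b)
adj-complement G {a} {b} a≢b with a ≟ b
... | yes a≡b = ⊥-elim (a≢b a≡b)
... | no _    = ∧-identityʳ _

IsEdge : ∀ {n} → Graph n → Subset n → Set
IsEdge {n} H S = ∃₂ λ (a b : Fin n) → T (adj H a b) × S ≡ ⁅ a ⁆ ∪ ⁅ b ⁆

tokenAdj⇒IsEdge : ∀ {n} (H : Graph n) A B → T (tokenAdj H A B) → IsEdge H (A △ B)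
tokenAdj⇒IsEdge {n} H A B t =
  let a , t′ = satisfied (any⁻ _ (allFin n) t)
      b , t″ = satisfied (any⁻ _ (allFin n) t′)
      e , eq = to T-∧ t″
  in a , b , e , toWitness eq

IsEdge⇒tokenAdj : ∀ {n} (H : Graph n) A B → IsEdge H (A △ B) → T (tokenAdj H A B)
IsEdge⇒tokenAdj H A B (a , b , e , eq) =
  any⁺ _ (lose (∈-allFin a) (any⁺ _ (lose (∈-allFin b) (from T-∧ (e , fromWitness eq)))))

IsEdge⇒∣S∣≡2 : ∀ {n} (H : Graph n) {S} → IsEdge H S → ∣ S ∣ ≡ 2
IsEdge⇒∣S∣≡2 H (a , b , e , refl) = ∣⁅x⁆∪⁅y⁆∣≡2 (adj⇒≢ H e)

∣S∣≡2⇒IsEdge⊎IsEdge-complement : ∀ {n} (G : Graph n) S → ∣ S ∣ ≡ 2 →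
  IsEdge G S ⊎ IsEdge (complement G) S
∣S∣≡2⇒IsEdge⊎IsEdge-complement G S ∣S∣≡2
  with a , b , a≢b , S≡⁅a⁆∪⁅b⁆ ← ∣p∣≡2⇒p≡⁅x⁆∪⁅y⁆ S ∣S∣≡2
  with adj G a b in e
... | true  = inj₁ (a , b , subst T (sym e) _ , S≡⁅a⁆∪⁅b⁆)
... | false = inj₂ (a , b , subst T (sym (trans (adj-complement G a≢b) (cong not e))) _ , S≡⁅a⁆∪⁅b⁆)

IsEdge-complement-disjoint : ∀ {n} (G : Graph n) {S} → IsEdge G S → ¬ IsEdge (complement G) S
IsEdge-complement-disjoint G (a , b , g , refl) (c , d , h , eq) =
  subst T (to T-not-≡ not-adj-cd) adj-cd
  where
  adj-cd : T (adj G c d)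
  adj-cd = subst T (adj-respects-pair G (adj⇒≢ G g) eq) g
  not-adj-cd : T (not (adj G c d))
  not-adj-cd = subst T (adj-complement G (adj⇒≢ (complement G) h)) h

tokenAdj-∨-complement : ∀ {n} (G : Graph n) A B →
  tokenAdj G A B ∨ tokenAdj (complement G) A B ≡ (∣ A △ B ∣ ≡ᵇ 2)
tokenAdj-∨-complement G A B = T⇔T⇒≡ (mk⇔ ⇒ ⇐)
  where
  ⇒ : T (tokenAdj G A B ∨ tokenAdj (complement G) A B) → T (∣ A △ B ∣ ≡ᵇ 2)
  ⇒ t = ≡⇒≡ᵇ ∣ A △ B ∣ 2
    ([ IsEdge⇒∣S∣≡2 G ∘ tokenAdj⇒IsEdge G A B
     , IsEdge⇒∣S∣≡2 (complement G) ∘ tokenAdj⇒IsEdge (complement G) A B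
     ] (to T-∨ t))
  ⇐ : T (∣ A △ B ∣ ≡ᵇ 2) → T (tokenAdj G A B ∨ tokenAdj (complement G) A B)
  ⇐ t = from T-∨ (Sum.map (IsEdge⇒tokenAdj G A B) (IsEdge⇒tokenAdj (complement G) A B)
                          (∣S∣≡2⇒IsEdge⊎IsEdge-complement G (A △ B) (≡ᵇ⇒≡ ∣ A △ B ∣ 2 t)))

tokenDegree-+-complement : ∀ {n k} (G : Graph n) (A : Subset n) → ∣ A ∣ ≡ k →
  tokenDegree G k A + tokenDegree (complement G) k A ≡ k * (n ∸ k)
tokenDegree-+-complement {n} G A refl = begin
  tokenDegree G k A + tokenDegree (complement G) k A
    ≡⟨ count-∨ disjoint (allSubsets n) ⟨
  count (λ B → isToken k B ∧ tokenAdj G A B ∨ isToken k B ∧ tokenAdj (complement G) A B) (allSubsets n)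
    ≡⟨ count-cong merge (allSubsets n) ⟩
  count (λ B → isToken k B ∧ (∣ A △ B ∣ ≡ᵇ 2)) (allSubsets n)
    ≡⟨ count-sameSize-distance2 A ⟩
  k * (n ∸ k) ∎
  where
  open ≡-Reasoning
  k = ∣ A ∣
  disjoint : ∀ B → T (isToken k B ∧ tokenAdj G A B) → ¬ T (isToken k B ∧ tokenAdj (complement G) A B)
  disjoint B t u = IsEdge-complement-disjoint G
    (tokenAdj⇒IsEdge G A B (proj₂ (to T-∧ t))) (tokenAdj⇒IsEdge (complement G) A B (proj₂ (to T-∧ u)))
  merge : ∀ B → isToken k B ∧ tokenAdj G A B ∨ isToken k B ∧ tokenAdj (complement G) A B
              ≡ isToken k B ∧ (∣ A △ B ∣ ≡ᵇ 2)
  merge B = trans (sym (∧-distribˡ-∨ (isToken k B) _ _)) (cong (isToken k B ∧_) (tokenAdj-∨-complement G A B))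

-- The degree identity holds for every k.
corollary1 : (n k : ℕ) (G : Graph n) → 1 ≤ k → k < n →
    TokenRegular G k → TokenRegular (complement G) k
corollary1 n k G _ _ (d , regular) = k * (n ∸ k) ∸ d , complement-regular
  where
  complement-regular : ∀ A → ∣ A ∣ ≡ k → tokenDegree (complement G) k A ≡ k * (n ∸ k) ∸ d
  complement-regular A ∣A∣≡k = begin
    tokenDegree (complement G) k A                         ≡⟨ m+n∸m≡n d _ ⟨
    d + tokenDegree (complement G) k A ∸ d                 ≡⟨ cong (λ x → x + _ ∸ d) (regular A ∣A∣≡k) ⟨
    tokenDegree G k A + tokenDegree (complement G) k A ∸ d ≡⟨ cong (_∸ d) (tokenDegree-+-complement G A ∣A∣≡k) ⟩
    k * (n ∸ k) ∸ d                                        ∎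
    where open ≡-Reasoning
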